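{- Let $G$ be an undirected graph and let $V(G)=V_1\cup V_2$ be a random bipartition in which every vertex is put into $V_1$ independently with probability $1/2$ (and otherwise into $V_2$). Fix an arbitrary $(k,l)$-tree $T_G$ in $G$. Then for any integer $t$ with $0\le t\le (k-1)/2$, \[\Pr\left[|\mathrm{la}(T_G)| \le k + \tfrac{l}{2} - t\right] \ge \frac{1}{2^{k+1}}\binom{k-1}{2t}.\]
   Context: A $(k,l)$-tree in $G$ is a subgraph of $G$ that is a tree with exactly $k$ vertices, exactly $l$ of which are leaves. For a subtree $T$ of $G$, let $L(T)$ be its set of leaves and $I(T)=V(T)\setminus L(T)$ its set of internal vertices, and define the set of labellable elements $\mathrm{la}(T)=L(T)\cup (I(T)\cap V_1)\cup\{uv\in E(T) : u,v\in V_2\}$ (a set of vertices and edges). -}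

module Defs where

open import Data.Nat using (ℕ; zero; suc; _+_; _*_; _≤_; _≤?_; _≡ᵇ_)
open import Data.Bool using (Bool; true; false; not; _∧_; if_then_else_)
open import Data.Fin using (Fin; zero; suc; _≟_)
open import Data.List using (List; []; _∷_; _++_; map; length; filterᵇ; filter; concatMap)
open import Data.List.Membership.Propositional using (_∈_)
open import Data.List.Relation.Unary.All using (All)
open import Data.List.Relation.Unary.AllPairs using (AllPairs)
open import Data.List.Relation.Unary.Unique.Propositional using (Unique)
open import Data.Product using (_×_; _,_; proj₁; proj₂)
open import Data.Sum using (_⊎_)
open import Relation.Nullary using (¬_; does)
open import Relation.Binary.PropositionalEquality using (_≡_; _≢_)

record Graph (n : ℕ) : Set₁ where
  field
    Adj     : Fin n → Fin n → Set
    sym     : ∀ {u v} → Adj u v → Adj v u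
    irrefl  : ∀ {u} → ¬ Adj u u

Edge : ℕ → Set
Edge n = Fin n × Fin n

SameEdge : ∀ {n} → Edge n → Edge n → Set
SameEdge (u , v) (u' , v') = (u ≡ u' × v ≡ v') ⊎ (u ≡ v' × v ≡ u')

data Reach {n} (es : List (Edge n)) : Fin n → Fin n → Set where
  here : ∀ {u} → Reach es u u
  fwd  : ∀ {u v w} → (u , v) ∈ es → Reach es v w → Reach es u w
  bwd  : ∀ {u v w} → (v , u) ∈ es → Reach es v w → Reach es u w

record IsSubtree {n} (G : Graph n) (vs : List (Fin n)) (es : List (Edge n)) : Set where
  field
    vs-unique   : Unique vs
    es-in-G     : All (λ e → Graph.Adj G (proj₁ e) (proj₂ e)) es
    es-in-vs    : All (λ e → proj₁ e ∈ vs × proj₂ e ∈ vs) es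
    es-unique   : AllPairs (λ e f → ¬ SameEdge e f) es
    connected   : ∀ {u v} → u ∈ vs → v ∈ vs → Reach es u v
    edge-count  : length es + 1 ≡ length vs

incidentᵇ : ∀ {n} → Fin n → Edge n → Bool
incidentᵇ v (a , b) with does (v ≟ a) | does (v ≟ b)
... | false | false = false
... | _     | _     = true

deg : ∀ {n} → List (Edge n) → Fin n → ℕ
deg es v = length (filterᵇ (incidentᵇ v) es)

isLeafᵇ : ∀ {n} → List (Edge n) → Fin n → Bool
isLeafᵇ es v = deg es v ≡ᵇ 1

numLeaves : ∀ {n} → List (Fin n) → List (Edge n) → ℕ
numLeaves vs es = length (filterᵇ (isLeafᵇ es) vs)

-- A bipartition: σ v = true means v ∈ V₁, false means v ∈ V₂.
-- |la(T)| = |L(T)| + |I(T) ∩ V₁| + |{uv ∈ E(T) : u, v ∈ V₂}|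
laSize : ∀ {n} → (Fin n → Bool) → List (Fin n) → List (Edge n) → ℕ
laSize σ vs es =
  numLeaves vs es
  + length (filterᵇ (λ v → not (isLeafᵇ es v) ∧ σ v) vs)
  + length (filterᵇ (λ e → not (σ (proj₁ e)) ∧ not (σ (proj₂ e))) es)

consF : ∀ {n} → Bool → (Fin n → Bool) → Fin (suc n) → Bool
consF b f zero    = b
consF b f (suc i) = f i

allBipartitions : (n : ℕ) → List (Fin n → Bool)
allBipartitions zero    = (λ ()) ∷ []
allBipartitions (suc n) = concatMap (λ f → consF false f ∷ consF true f ∷ []) (allBipartitions n)

-- number of bipartitions σ with |la(T)| ≤ k + l/2 - t, i.e. 2|la(T)| + 2t ≤ 2k + l.
-- Pr[...] = goodCount / 2^n.
goodCount : ∀ {n} → List (Fin n) → List (Edge n) → (k l t : ℕ) → ℕ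
goodCount {n} vs es k l t =
  length (filter (λ σ → 2 * laSize σ vs es + 2 * t ≤? 2 * k + l) (allBipartitions n))

-- Compare a bipartition σ with its complement: every leaf is labellable under both, every
-- internal vertex under exactly one, and every tree edge under exactly one unless σ cuts it,
-- so |la_σ| + |la_¬σ| = l + k + (k - 1) - cut(σ).  Hence whenever σ cuts at least 2t tree
-- edges, σ or ¬σ satisfies |la| ≤ k + l/2 - t.  Listing the tree edges so that each one
-- attaches a fresh leaf, the side of that leaf decides whether the edge is cut independently
-- of the later edges; so the number of cut tree edges is binomial with parameters k - 1 and
-- 1/2, and Pr[exactly 2t cut] = C(k-1, 2t) / 2^(k-1) ≤ 2 Pr[|la| ≤ k + l/2 - t].
module Submission where

import Algebra.Properties.CommutativeSemigroup
open import Data.Bool using (Bool; true; false; not; _∧_; _xor_; T)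
open import Data.Bool.Properties using (xor-comm)
open import Data.Empty using (⊥-elim)
open import Data.Fin using (Fin; zero; suc)
open import Data.Fin.Properties using () renaming (_≟_ to _≟ᶠ_)
open import Data.List using (List; []; _∷_; _++_; length; filterᵇ; filter; concatMap)
open import Data.List.Membership.Propositional using (_∈_; _∉_; find)
open import Data.List.Membership.Propositional.Properties using (∈-∃++; ∈-++⁻; ∈-++⁺ˡ; ∈-++⁺ʳ)
open import Data.List.Relation.Unary.All as All using (All; []; _∷_; all?)
open import Data.List.Relation.Unary.All.Properties using (¬All⇒Any¬)
open import Data.List.Relation.Unary.AllPairs using ([]; _∷_)
open import Data.List.Relation.Unary.Any using (here; there)
open import Data.List.Relation.Unary.Unique.Propositional using (Unique)
open import Data.Nat using (ℕ; zero; suc; _+_; _*_; _^_; _≤_; _<_; _∸_; _≤?_; _≡ᵇ_; z≤n; s≤s)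
open import Data.Nat.Combinatorics using (_C_; nCk+nC[k+1]≡[n+1]C[k+1])
open import Data.Nat.Properties
open import Data.Nat.Tactic.RingSolver using (solve-∀)
open import Data.Product as Product using (_×_; _,_; proj₁; proj₂; ∃)
open import Data.Sum using (_⊎_; inj₁; inj₂)
open import Data.Unit using (tt)
open import Data.Vec.Functional using (updateAt)
open import Data.Vec.Functional.Properties using (updateAt-updates; updateAt-minimal)
open import Function using (_∘_; const)
open import Level using (0ℓ)
open import Relation.Binary.PropositionalEquality
open import Relation.Nullary using (Dec; does; yes; no)
open import Relation.Unary using (Pred; Decidable)

open import Defs
open Algebra.Properties.CommutativeSemigroup +-commutativeSemigroup using (interchange; x∙yz≈y∙xz)

iverson : Bool → ℕ
iverson true  = 1
iverson false = 0

iverson-yes : ∀ {P : Set} (P? : Dec P) → P → iverson (does P?) ≡ 1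
iverson-yes (yes _) _  = refl
iverson-yes (no ¬p) p = ⊥-elim (¬p p)

sumBy : {A : Set} → (A → ℕ) → List A → ℕ
sumBy f []       = 0
sumBy f (x ∷ xs) = f x + sumBy f xs

module _ {A : Set} where

  sumBy-cong : {f g : A → ℕ} → (∀ x → f x ≡ g x) → ∀ xs → sumBy f xs ≡ sumBy g xs
  sumBy-cong f≗g []       = refl
  sumBy-cong f≗g (x ∷ xs) = cong₂ _+_ (f≗g x) (sumBy-cong f≗g xs)

  sumBy-+ : (f g : A → ℕ) → ∀ xs → sumBy (λ x → f x + g x) xs ≡ sumBy f xs + sumBy g xs
  sumBy-+ f g []       = refl
  sumBy-+ f g (x ∷ xs) = trans (cong (f x + g x +_) (sumBy-+ f g xs))
                               (interchange (f x) (g x) (sumBy f xs) (sumBy g xs))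

  sumBy-mono : {f g : A → ℕ} → (∀ x → f x ≤ g x) → ∀ xs → sumBy f xs ≤ sumBy g xs
  sumBy-mono f≤g []       = z≤n
  sumBy-mono f≤g (x ∷ xs) = +-mono-≤ (f≤g x) (sumBy-mono f≤g xs)

  sumBy-++ : (f : A → ℕ) → ∀ xs ys → sumBy f (xs ++ ys) ≡ sumBy f xs + sumBy f ys
  sumBy-++ f []       ys = refl
  sumBy-++ f (x ∷ xs) ys = trans (cong (f x +_) (sumBy-++ f xs ys)) (sym (+-assoc (f x) _ _))

  length≡sumBy-1 : ∀ (xs : List A) → length xs ≡ sumBy (λ _ → 1) xs
  length≡sumBy-1 []       = refl
  length≡sumBy-1 (x ∷ xs) = cong suc (length≡sumBy-1 xs)

  length-filterᵇ : (p : A → Bool) → ∀ xs → length (filterᵇ p xs) ≡ sumBy (λ x → iverson (p x)) xs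
  length-filterᵇ p []       = refl
  length-filterᵇ p (x ∷ xs) with p x
  ... | true  = cong suc (length-filterᵇ p xs)
  ... | false = length-filterᵇ p xs

  length-filter : {P : Pred A 0ℓ} (P? : Decidable P) → ∀ xs →
                  length (filter P? xs) ≡ sumBy (λ x → iverson (does (P? x))) xs
  length-filter P? []       = refl
  length-filter P? (x ∷ xs) with does (P? x)
  ... | true  = cong suc (length-filter P? xs)
  ... | false = length-filter P? xs

  ∈-++-skip : ∀ {x y : A} xs ys → x ∈ xs ++ y ∷ ys → x ≢ y → x ∈ xs ++ ys
  ∈-++-skip xs ys x∈ x≢y with ∈-++⁻ xs x∈
  ... | inj₁ x∈xs         = ∈-++⁺ˡ x∈xs
  ... | inj₂ (here x≡y)   = ⊥-elim (x≢y x≡y)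
  ... | inj₂ (there x∈ys) = ∈-++⁺ʳ xs x∈ys

  sumBy-mono-⊆ : (w : A → ℕ) {xs ys : List A} → Unique xs → (∀ {x} → x ∈ xs → x ∈ ys) →
                 sumBy w xs ≤ sumBy w ys
  sumBy-mono-⊆ w {[]}     _              _   = z≤n
  sumBy-mono-⊆ w {x ∷ xs} (x∉xs ∷ uniq) xs⊆ with ∈-∃++ (xs⊆ (here refl))
  ... | as , bs , refl = begin
    w x + sumBy w xs                ≤⟨ +-monoʳ-≤ (w x) (sumBy-mono-⊆ w uniq xs⊆as++bs) ⟩
    w x + sumBy w (as ++ bs)        ≡⟨ cong (w x +_) (sumBy-++ w as bs) ⟩
    w x + (sumBy w as + sumBy w bs) ≡⟨ x∙yz≈y∙xz (w x) (sumBy w as) (sumBy w bs) ⟩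
    sumBy w as + sumBy w (x ∷ bs)   ≡⟨ sumBy-++ w as (x ∷ bs) ⟨
    sumBy w (as ++ x ∷ bs)          ∎
    where
    open ≤-Reasoning
    xs⊆as++bs : ∀ {y} → y ∈ xs → y ∈ as ++ bs
    xs⊆as++bs y∈xs = ∈-++-skip as bs (xs⊆ (there y∈xs)) (λ y≡x → All.lookup x∉xs y∈xs (sym y≡x))

  length-mono-⊆ : {xs ys : List A} → Unique xs → (∀ {x} → x ∈ xs → x ∈ ys) → length xs ≤ length ys
  length-mono-⊆ {xs} {ys} uniq xs⊆ys = subst₂ _≤_ (sym (length≡sumBy-1 xs)) (sym (length≡sumBy-1 ys))
                                                 (sumBy-mono-⊆ (λ _ → 1) uniq xs⊆ys)

Bipartition : ℕ → Set
Bipartition n = Fin n → Bool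

total : ∀ {n} → (Bipartition n → ℕ) → ℕ
total {n} g = sumBy g (allBipartitions n)

-- Without function extensionality, bipartitions are compared pointwise.
Invariant : ∀ {n} → (Bipartition n → ℕ) → Set
Invariant g = ∀ {σ τ} → (∀ i → σ i ≡ τ i) → g σ ≡ g τ

total-cong : ∀ {n} {f g : Bipartition n → ℕ} → (∀ σ → f σ ≡ g σ) → total f ≡ total g
total-cong {n} f≗g = sumBy-cong f≗g (allBipartitions n)

total-+ : ∀ {n} (f g : Bipartition n → ℕ) → total (λ σ → f σ + g σ) ≡ total f + total g
total-+ {n} f g = sumBy-+ f g (allBipartitions n)

total-mono : ∀ {n} {f g : Bipartition n → ℕ} → (∀ σ → f σ ≤ g σ) → total f ≤ total g
total-mono {n} f≤g = sumBy-mono f≤g (allBipartitions n)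

splitFirst : ∀ {n} → (Bipartition (suc n) → ℕ) → Bipartition n → ℕ
splitFirst g f = g (consF false f) + g (consF true f)

total-splitFirst : ∀ {n} (g : Bipartition (suc n) → ℕ) → total g ≡ total (splitFirst g)
total-splitFirst {n} g = pairs (allBipartitions n)
  where
  pairs : ∀ fs → sumBy g (concatMap (λ f → consF false f ∷ consF true f ∷ []) fs) ≡ sumBy (splitFirst g) fs
  pairs []       = refl
  pairs (f ∷ fs) = trans (cong (λ s → g (consF false f) + (g (consF true f) + s)) (pairs fs))
                         (sym (+-assoc (g (consF false f)) _ _))

splitFirst-invariant : ∀ {n} {g : Bipartition (suc n) → ℕ} → Invariant g → Invariant (splitFirst g)
splitFirst-invariant inv σ≗τ = cong₂ _+_ (inv (consF-cong σ≗τ)) (inv (consF-cong σ≗τ))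
  where
  consF-cong : ∀ {n} {b} {σ τ : Bipartition n} → (∀ i → σ i ≡ τ i) → ∀ i → consF b σ i ≡ consF b τ i
  consF-cong σ≗τ zero    = refl
  consF-cong σ≗τ (suc i) = σ≗τ i

total-const : ∀ n c → total {n} (λ _ → c) ≡ c * 2 ^ n
total-const zero    c = trans (+-identityʳ c) (sym (*-identityʳ c))
total-const (suc n) c = begin
  total {suc n} (λ _ → c) ≡⟨ total-splitFirst {n} (λ _ → c) ⟩
  total {n} (λ _ → c + c) ≡⟨ total-const n (c + c) ⟩
  (c + c) * 2 ^ n         ≡⟨ doubling c (2 ^ n) ⟩
  c * (2 * 2 ^ n)         ∎
  where
  open ≡-Reasoning
  doubling : ∀ c x → (c + c) * x ≡ c * (2 * x)
  doubling = solve-∀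

fixAt : ∀ {n} → (Bipartition n → ℕ) → Fin n → Bool → Bipartition n → ℕ
fixAt g x b σ = g (updateAt σ x (const b))

total-fixAt : ∀ {n} (g : Bipartition n → ℕ) → Invariant g → ∀ x →
  2 * total g ≡ total (fixAt g x false) + total (fixAt g x true)
total-fixAt {suc n} g inv zero = begin
  2 * total g                                            ≡⟨ cong (2 *_) (total-splitFirst g) ⟩
  2 * total (splitFirst g)                               ≡⟨ cong (2 *_) (total-+ (g ∘ consF false) (g ∘ consF true)) ⟩
  2 * (total (g ∘ consF false) + total (g ∘ consF true)) ≡⟨ double-sum (total (g ∘ consF false)) _ ⟩
  total (g ∘ consF false) + total (g ∘ consF false)
    + (total (g ∘ consF true) + total (g ∘ consF true))  ≡⟨ cong₂ _+_ (fixed false) (fixed true) ⟨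
  total (fixAt g zero false) + total (fixAt g zero true) ∎
  where
  open ≡-Reasoning
  double-sum : ∀ a b → 2 * (a + b) ≡ a + a + (b + b)
  double-sum = solve-∀
  fixed : ∀ b → total (fixAt g zero b) ≡ total (g ∘ consF b) + total (g ∘ consF b)
  fixed b = trans (total-splitFirst (fixAt g zero b))
                  (trans (total-cong {n} λ f → cong₂ _+_ (inv (overwrite false f)) (inv (overwrite true f)))
                         (total-+ (g ∘ consF b) (g ∘ consF b)))
    where
    overwrite : ∀ c (f : Bipartition n) i → updateAt (consF c f) zero (const b) i ≡ consF b f i
    overwrite c f zero    = refl
    overwrite c f (suc i) = refl
total-fixAt {suc n} g inv (suc x) = begin
  2 * total g              ≡⟨ cong (2 *_) (total-splitFirst g) ⟩
  2 * total (splitFirst g) ≡⟨ total-fixAt (splitFirst g) (splitFirst-invariant inv) x ⟩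
  total (fixAt (splitFirst g) x false) + total (fixAt (splitFirst g) x true) ≡⟨ cong₂ _+_ (fixed false) (fixed true) ⟨
  total (fixAt g (suc x) false) + total (fixAt g (suc x) true) ∎
  where
  open ≡-Reasoning
  fixed : ∀ b → total (fixAt g (suc x) b) ≡ total (fixAt (splitFirst g) x b)
  fixed b = trans (total-splitFirst (fixAt g (suc x) b))
                  (total-cong {n} λ f → cong₂ _+_ (inv (commute false f)) (inv (commute true f)))
    where
    commute : ∀ c (f : Bipartition n) i → updateAt (consF c f) (suc x) (const b) i ≡ consF c (updateAt f x (const b)) i
    commute c f zero    = refl
    commute c f (suc i) = refl

total-not : ∀ {n} (g : Bipartition n → ℕ) → Invariant g → total (g ∘ (not ∘_)) ≡ total g
total-not {zero}  g inv = cong (_+ 0) (inv (λ ()))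
total-not {suc n} g inv = begin
  total (g ∘ (not ∘_))              ≡⟨ total-splitFirst (g ∘ (not ∘_)) ⟩
  total (splitFirst (g ∘ (not ∘_))) ≡⟨ total-cong swapped ⟩
  total (splitFirst g ∘ (not ∘_))   ≡⟨ total-not (splitFirst g) (splitFirst-invariant inv) ⟩
  total (splitFirst g)              ≡⟨ total-splitFirst g ⟨
  total g                           ∎
  where
  open ≡-Reasoning
  commute : ∀ c (f : Bipartition n) i → not (consF c f i) ≡ consF (not c) (not ∘ f) i
  commute c f zero    = refl
  commute c f (suc i) = refl
  swapped : ∀ (f : Bipartition n) → splitFirst (g ∘ (not ∘_)) f ≡ splitFirst g (not ∘ f)
  swapped f = trans (cong₂ _+_ (inv (commute false f)) (inv (commute true f)))
                    (+-comm (g (consF true (not ∘ f))) _)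

cutBy : ∀ {n} → Bipartition n → Edge n → ℕ
cutBy σ (u , v) = iverson (σ u xor σ v)

cutSize : ∀ {n} → Bipartition n → List (Edge n) → ℕ
cutSize σ = sumBy (cutBy σ)

cutSize-cong : ∀ {n} (F : List (Edge n)) {σ τ : Bipartition n} → (∀ i → σ i ≡ τ i) → cutSize σ F ≡ cutSize τ F
cutSize-cong F σ≗τ = sumBy-cong (λ { (u , v) → cong₂ (λ a b → iverson (a xor b)) (σ≗τ u) (σ≗τ v) }) F

Avoids : ∀ {n} → Fin n → List (Edge n) → Set
Avoids v = All (λ e → proj₁ e ≢ v × proj₂ e ≢ v)

cutSize-avoids : ∀ {n} {v : Fin n} {F} → Avoids v F → ∀ σ b → cutSize (updateAt σ v (const b)) F ≡ cutSize σ F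
cutSize-avoids []                                      σ b = refl
cutSize-avoids {v = v} {(a , c) ∷ F} ((a≢v , c≢v) ∷ avoids) σ b =
  cong₂ _+_ (cong₂ (λ x y → iverson (x xor y)) (updateAt-minimal a v σ a≢v) (updateAt-minimal c v σ c≢v))
            (cutSize-avoids avoids σ b)

data PeelOrder {n} : List (Edge n) → Set where
  []   : PeelOrder []
  peel : ∀ {v p F} → p ≢ v → Avoids v F → PeelOrder F → PeelOrder ((v , p) ∷ F)

exactCut : ∀ {n} → List (Edge n) → ℕ → ℕ
exactCut F j = total (λ σ → iverson (cutSize σ F ≡ᵇ j))

exactCut-peel : ∀ {n} {v p : Fin n} {F} → p ≢ v → Avoids v F → ∀ j →
  2 * exactCut ((v , p) ∷ F) j ≡ exactCut F j + total (λ σ → iverson (suc (cutSize σ F) ≡ᵇ j))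
exactCut-peel {n} {v} {p} {F} p≢v avoids j = begin
  2 * total g                                          ≡⟨ total-fixAt g g-invariant v ⟩
  total (fixAt g v false) + total (fixAt g v true)     ≡⟨ total-+ (fixAt g v false) (fixAt g v true) ⟨
  total (λ σ → fixAt g v false σ + fixAt g v true σ)   ≡⟨ total-cong both-sides ⟩
  total (λ σ → iverson (cutSize σ F ≡ᵇ j) + iverson (suc (cutSize σ F) ≡ᵇ j))
                                                       ≡⟨ total-+ (λ σ → iverson (cutSize σ F ≡ᵇ j)) _ ⟩
  exactCut F j + total (λ σ → iverson (suc (cutSize σ F) ≡ᵇ j)) ∎
  where
  open ≡-Reasoning
  g : Bipartition n → ℕ
  g σ = iverson (cutSize σ ((v , p) ∷ F) ≡ᵇ j)
  g-invariant : Invariant g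
  g-invariant σ≗τ = cong (λ c → iverson (c ≡ᵇ j)) (cutSize-cong ((v , p) ∷ F) σ≗τ)
  fixed : ∀ σ b → cutSize (updateAt σ v (const b)) ((v , p) ∷ F) ≡ iverson (b xor σ p) + cutSize σ F
  fixed σ b = cong₂ _+_ (cong₂ (λ x y → iverson (x xor y)) (updateAt-updates v σ) (updateAt-minimal p v σ p≢v))
                        (cutSize-avoids avoids σ b)
  one-of-two : ∀ c d → iverson (iverson c + d ≡ᵇ j) + iverson (iverson (not c) + d ≡ᵇ j)
                     ≡ iverson (d ≡ᵇ j) + iverson (suc d ≡ᵇ j)
  one-of-two false d = refl
  one-of-two true  d = +-comm (iverson (suc d ≡ᵇ j)) _
  both-sides : ∀ σ → fixAt g v false σ + fixAt g v true σ
                   ≡ iverson (cutSize σ F ≡ᵇ j) + iverson (suc (cutSize σ F) ≡ᵇ j)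
  both-sides σ rewrite fixed σ false | fixed σ true = one-of-two (σ p) (cutSize σ F)

exactCut-count : ∀ {n} {F : List (Edge n)} → PeelOrder F → ∀ j → exactCut F j * 2 ^ length F ≡ (length F C j) * 2 ^ n
exactCut-count {n} [] zero    = trans (*-identityʳ _) (total-const n 1)
exactCut-count {n} [] (suc j) = trans (*-identityʳ _) (total-const n 0)
exactCut-count {n} {(v , p) ∷ F} (peel p≢v avoids peelF) j = begin
  exactCut ((v , p) ∷ F) j * (2 * 2 ^ length F) ≡⟨ *-assoc-comm (exactCut ((v , p) ∷ F) j) (2 ^ length F) ⟩
  2 * exactCut ((v , p) ∷ F) j * 2 ^ length F   ≡⟨ cong (_* 2 ^ length F) (exactCut-peel p≢v avoids j) ⟩
  (exactCut F j + total (λ σ → iverson (suc (cutSize σ F) ≡ᵇ j))) * 2 ^ length F ≡⟨ pascal j ⟩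
  (suc (length F) C j) * 2 ^ n ∎
  where
  open ≡-Reasoning
  *-assoc-comm : ∀ a b → a * (2 * b) ≡ 2 * a * b
  *-assoc-comm = solve-∀
  pascal : ∀ j → (exactCut F j + total (λ σ → iverson (suc (cutSize σ F) ≡ᵇ j))) * 2 ^ length F
                 ≡ (suc (length F) C j) * 2 ^ n
  pascal zero = begin
    (exactCut F 0 + total {n} (λ _ → 0)) * 2 ^ length F ≡⟨ cong (λ z → (exactCut F 0 + z) * 2 ^ length F) (total-const n 0) ⟩
    (exactCut F 0 + 0) * 2 ^ length F                   ≡⟨ cong (_* 2 ^ length F) (+-identityʳ (exactCut F 0)) ⟩
    exactCut F 0 * 2 ^ length F                         ≡⟨ exactCut-count peelF 0 ⟩
    1 * 2 ^ n                                           ∎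
  pascal (suc j) = begin
    (exactCut F (suc j) + exactCut F j) * 2 ^ length F                 ≡⟨ *-distribʳ-+ (2 ^ length F) (exactCut F (suc j)) _ ⟩
    exactCut F (suc j) * 2 ^ length F + exactCut F j * 2 ^ length F    ≡⟨ cong₂ _+_ (exactCut-count peelF (suc j)) (exactCut-count peelF j) ⟩
    (length F C suc j) * 2 ^ n + (length F C j) * 2 ^ n               ≡⟨ *-distribʳ-+ (2 ^ n) (length F C suc j) _ ⟨
    ((length F C suc j) + (length F C j)) * 2 ^ n                     ≡⟨ cong (_* 2 ^ n) (+-comm (length F C suc j) _) ⟩
    ((length F C j) + (length F C suc j)) * 2 ^ n                     ≡⟨ cong (_* 2 ^ n) (nCk+nC[k+1]≡[n+1]C[k+1] (length F) j) ⟩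
    (suc (length F) C suc j) * 2 ^ n                                  ∎

_∈ᵤ_ : ∀ {n} → Edge n → List (Edge n) → Set
(u , v) ∈ᵤ es = (u , v) ∈ es ⊎ (v , u) ∈ es

module _ {n} {es : List (Edge n)} where

  orientIn : ∀ {e} → e ∈ᵤ es → Edge n
  orientIn {u , v} (inj₁ _) = u , v
  orientIn {u , v} (inj₂ _) = v , u

  orient : ∀ {F} → All (_∈ᵤ es) F → List (Edge n)
  orient = All.reduce orientIn

  orient-⊆ : ∀ {F} (ms : All (_∈ᵤ es) F) → All (_∈ es) (orient ms)
  orient-⊆ []            = []
  orient-⊆ (inj₁ m ∷ ms) = m ∷ orient-⊆ ms
  orient-⊆ (inj₂ m ∷ ms) = m ∷ orient-⊆ ms

  cutSize-orient : ∀ σ {F} (ms : All (_∈ᵤ es) F) → cutSize σ (orient ms) ≡ cutSize σ F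
  cutSize-orient σ []                          = refl
  cutSize-orient σ (inj₁ _ ∷ ms)               = cong (cutBy σ _ +_) (cutSize-orient σ ms)
  cutSize-orient σ {(u , v) ∷ _} (inj₂ _ ∷ ms) =
    cong₂ _+_ (cong iverson (xor-comm (σ v) (σ u))) (cutSize-orient σ ms)

  orient-avoids : ∀ {v F} (ms : All (_∈ᵤ es) F) → Avoids v F → Avoids v (orient ms)
  orient-avoids []            []                 = []
  orient-avoids (inj₁ _ ∷ ms) (avoid ∷ avoids)   = avoid ∷ orient-avoids ms avoids
  orient-avoids (inj₂ _ ∷ ms) ((x , y) ∷ avoids) = (y , x) ∷ orient-avoids ms avoids

  orient-unique : ∀ {F} → PeelOrder F → (ms : All (_∈ᵤ es) F) → Unique (orient ms)
  orient-unique []                         []       = []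
  orient-unique (peel _ avoids peelF) (m ∷ ms) =
    All.map (avoider-differs m) (orient-avoids ms avoids) ∷ orient-unique peelF ms
    where
    avoider-differs : ∀ {v p f} (m : (v , p) ∈ᵤ es) → proj₁ f ≢ v × proj₂ f ≢ v → orientIn m ≢ f
    avoider-differs (inj₁ _) (f₁≢v , _) refl = f₁≢v refl
    avoider-differs (inj₂ _) (_ , f₂≢v) refl = f₂≢v refl

  cutSize-mono-peel : ∀ {F} → PeelOrder F → All (_∈ᵤ es) F → ∀ σ → cutSize σ F ≤ cutSize σ es
  cutSize-mono-peel {F} peelF ms σ = begin
    cutSize σ F           ≡⟨ cutSize-orient σ ms ⟨
    cutSize σ (orient ms) ≤⟨ sumBy-mono-⊆ (cutBy σ) (orient-unique peelF ms) (All.lookup (orient-⊆ ms)) ⟩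
    cutSize σ es          ∎
    where open ≤-Reasoning

module _ {n : ℕ} where
  open import Data.List.Membership.DecPropositional (_≟ᶠ_ {n}) using (_∈?_)

  unreached : ∀ {vs S : List (Fin n)} → Unique vs → length S < length vs → ∃ λ u → u ∈ vs × u ∉ S
  unreached {vs = vs} {S} vs-unique |S|<|vs| with all? (_∈? S) vs
  ... | yes vs⊆S = ⊥-elim (<⇒≱ |S|<|vs| (length-mono-⊆ vs-unique (All.lookup vs⊆S)))
  ... | no ¬vs⊆S = find (¬All⇒Any¬ (_∈? S) vs ¬vs⊆S)

  crossingEdge : ∀ {es : List (Edge n)} {a u} (S : List (Fin n)) → Reach es a u → a ∈ S → u ∉ S →
    ∃ λ w → ∃ λ p → w ∉ S × p ∈ S × (w , p) ∈ᵤ es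
  crossingEdge S here a∈S u∉S = ⊥-elim (u∉S a∈S)
  crossingEdge {a = a} S (fwd {v = b} ab∈es reach) a∈S u∉S with b ∈? S
  ... | yes b∈S = crossingEdge S reach b∈S u∉S
  ... | no  b∉S = b , a , b∉S , a∈S , inj₂ ab∈es
  crossingEdge {a = a} S (bwd {v = b} ba∈es reach) a∈S u∉S with b ∈? S
  ... | yes b∈S = crossingEdge S reach b∈S u∉S
  ... | no  b∉S = b , a , b∉S , a∈S , inj₁ ba∈es

module Spanning {n} {G : Graph n} {vs es} (tree : IsSubtree G vs es) {r} (r∈vs : r ∈ vs) where
  open IsSubtree tree

  record Grown (m : ℕ) : Set where
    field
      reached        : List (Fin n)
      edges          : List (Edge n)
      reached-length : length reached ≡ suc m
      edges-length   : length edges ≡ m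
      root-reached   : r ∈ reached
      edges-reached  : All (λ e → proj₁ e ∈ reached × proj₂ e ∈ reached) edges
      peelOrder      : PeelOrder edges
      edges-in-tree  : All (_∈ᵤ es) edges

  attach : ∀ {m} (grown : Grown m) {w p} → w ∉ Grown.reached grown → p ∈ Grown.reached grown →
           (w , p) ∈ᵤ es → Grown (suc m)
  attach grown {w} {p} w∉reached p∈reached wp∈es = record
    { reached        = w ∷ reached
    ; edges          = (w , p) ∷ edges
    ; reached-length = cong suc reached-length
    ; edges-length   = cong suc edges-length
    ; root-reached   = there root-reached
    ; edges-reached  = (here refl , there p∈reached) ∷ All.map (Product.map there there) edges-reached
    ; peelOrder      = peel (≢w p∈reached) (All.map (Product.map ≢w ≢w) edges-reached) peelOrder
    ; edges-in-tree  = wp∈es ∷ edges-in-tree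
    }
    where
    open Grown grown
    ≢w : ∀ {x} → x ∈ reached → x ≢ w
    ≢w x∈reached refl = w∉reached x∈reached

  grow : ∀ {m} → Grown m → suc m < length vs → Grown (suc m)
  grow grown m<|vs| =
    let u , u∈vs , u∉reached = unreached vs-unique (subst (_< length vs) (sym reached-length) m<|vs|)
        w , p , w∉reached , p∈reached , wp∈es = crossingEdge reached (connected r∈vs u∈vs) root-reached u∉reached
    in  attach grown w∉reached p∈reached wp∈es
    where open Grown grown

  build : ∀ m → m < length vs → Grown m
  build zero    _      = record
    { reached = r ∷ [] ; edges = [] ; reached-length = refl ; edges-length = refl
    ; root-reached = here refl ; edges-reached = [] ; peelOrder = [] ; edges-in-tree = [] }
  build (suc m) m<|vs| = grow (build m (<-trans (n<1+n m) m<|vs|)) m<|vs|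

spanningPeelOrder : ∀ {n} {G : Graph n} {vs es} → IsSubtree G vs es →
  ∃ λ F → PeelOrder F × All (_∈ᵤ es) F × suc (length F) ≡ length vs
spanningPeelOrder {vs = []} tree = ⊥-elim (1+n≢0 (trans (+-comm 1 _) (IsSubtree.edge-count tree)))
spanningPeelOrder {vs = r ∷ _} {es} tree =
  edges , peelOrder , edges-in-tree , trans (cong suc edges-length) (trans (+-comm 1 _) (IsSubtree.edge-count tree))
  where
  open Spanning tree (here refl)
  open Grown (build (length es) (subst (length es <_) (IsSubtree.edge-count tree) (m<m+n (length es) (s≤s z≤n))))

vertexLabels : ∀ {n} → List (Edge n) → Bipartition n → Fin n → ℕ
vertexLabels es σ v = iverson (isLeafᵇ es v) + iverson (not (isLeafᵇ es v) ∧ σ v)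

edgeLabels : ∀ {n} → Bipartition n → Edge n → ℕ
edgeLabels σ (u , v) = iverson (not (σ u) ∧ not (σ v))

laSize≡sumBy : ∀ {n} (σ : Bipartition n) vs es →
  laSize σ vs es ≡ sumBy (vertexLabels es σ) vs + sumBy (edgeLabels σ) es
laSize≡sumBy σ vs es = begin
  laSize σ vs es
    ≡⟨ cong₂ _+_ (cong₂ _+_ (length-filterᵇ (isLeafᵇ es) vs) (length-filterᵇ _ vs)) (length-filterᵇ _ es) ⟩
  sumBy (λ v → iverson (isLeafᵇ es v)) vs + sumBy (λ v → iverson (not (isLeafᵇ es v) ∧ σ v)) vs
    + sumBy (edgeLabels σ) es
    ≡⟨ cong (_+ sumBy (edgeLabels σ) es) (sumBy-+ (λ v → iverson (isLeafᵇ es v)) _ vs) ⟨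
  sumBy (vertexLabels es σ) vs + sumBy (edgeLabels σ) es ∎
  where open ≡-Reasoning

laSize-cong : ∀ {n} vs es {σ τ : Bipartition n} → (∀ i → σ i ≡ τ i) → laSize σ vs es ≡ laSize τ vs es
laSize-cong vs es {σ} {τ} σ≗τ = begin
  laSize σ vs es                                          ≡⟨ laSize≡sumBy σ vs es ⟩
  sumBy (vertexLabels es σ) vs + sumBy (edgeLabels σ) es  ≡⟨ cong₂ _+_ (sumBy-cong vertex vs) (sumBy-cong edge es) ⟩
  sumBy (vertexLabels es τ) vs + sumBy (edgeLabels τ) es  ≡⟨ laSize≡sumBy τ vs es ⟨
  laSize τ vs es                                          ∎
  where
  open ≡-Reasoning
  vertex : ∀ v → vertexLabels es σ v ≡ vertexLabels es τ v
  vertex v = cong (λ b → iverson (isLeafᵇ es v) + iverson (not (isLeafᵇ es v) ∧ b)) (σ≗τ v)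
  edge : ∀ e → edgeLabels σ e ≡ edgeLabels τ e
  edge (u , v) = cong₂ (λ a b → iverson (not a ∧ not b)) (σ≗τ u) (σ≗τ v)

laSize-complement : ∀ {n} (σ : Bipartition n) vs es →
  laSize σ vs es + laSize (not ∘ σ) vs es + cutSize σ es ≡ numLeaves vs es + length vs + length es
laSize-complement σ vs es = begin
  laSize σ vs es + laSize (not ∘ σ) vs es + cutSize σ es
    ≡⟨ cong₂ (λ a b → a + b + cutSize σ es) (laSize≡sumBy σ vs es) (laSize≡sumBy (not ∘ σ) vs es) ⟩
  V σ + E σ + (V (not ∘ σ) + E (not ∘ σ)) + cutSize σ es
    ≡⟨ regroup (V σ) (E σ) (V (not ∘ σ)) (E (not ∘ σ)) (cutSize σ es) ⟩
  (V σ + V (not ∘ σ)) + (E σ + E (not ∘ σ) + cutSize σ es)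
    ≡⟨ cong₂ _+_ (sumBy-+ (vertexLabels es σ) _ vs) (cong (_+ cutSize σ es) (sumBy-+ (edgeLabels σ) _ es)) ⟨
  sumBy (λ v → vertexLabels es σ v + vertexLabels es (not ∘ σ) v) vs
    + (sumBy (λ e → edgeLabels σ e + edgeLabels (not ∘ σ) e) es + cutSize σ es)
    ≡⟨ cong (sumBy (λ v → vertexLabels es σ v + vertexLabels es (not ∘ σ) v) vs +_) (sumBy-+ (λ e → edgeLabels σ e + edgeLabels (not ∘ σ) e) (cutBy σ) es) ⟨
  sumBy (λ v → vertexLabels es σ v + vertexLabels es (not ∘ σ) v) vs
    + sumBy (λ e → edgeLabels σ e + edgeLabels (not ∘ σ) e + cutBy σ e) es
    ≡⟨ cong₂ _+_ (sumBy-cong vertex vs) (sumBy-cong edge es) ⟩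
  sumBy (λ v → iverson (isLeafᵇ es v) + 1) vs + sumBy (λ _ → 1) es
    ≡⟨ cong₂ _+_ (sumBy-+ (λ v → iverson (isLeafᵇ es v)) (λ _ → 1) vs) (sym (length≡sumBy-1 es)) ⟩
  sumBy (λ v → iverson (isLeafᵇ es v)) vs + sumBy (λ _ → 1) vs + length es
    ≡⟨ cong₂ (λ a b → a + b + length es) (length-filterᵇ (isLeafᵇ es) vs) (length≡sumBy-1 vs) ⟨
  numLeaves vs es + length vs + length es ∎
  where
  open ≡-Reasoning
  V E : Bipartition _ → ℕ
  V τ = sumBy (vertexLabels es τ) vs
  E τ = sumBy (edgeLabels τ) es
  regroup : ∀ a b c d e → a + b + (c + d) + e ≡ (a + c) + (b + d + e)
  regroup = solve-∀
  vertex : ∀ v → vertexLabels es σ v + vertexLabels es (not ∘ σ) v ≡ iverson (isLeafᵇ es v) + 1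
  vertex v with isLeafᵇ es v | σ v
  ... | true  | _     = refl
  ... | false | true  = refl
  ... | false | false = refl
  edge : ∀ e → edgeLabels σ e + edgeLabels (not ∘ σ) e + cutBy σ e ≡ 1
  edge (u , v) with σ u | σ v
  ... | true  | true  = refl
  ... | true  | false = refl
  ... | false | true  = refl
  ... | false | false = refl

≤-or-≤-of-sum≤double : ∀ {a b c} → a + b ≤ 2 * c → a ≤ c ⊎ b ≤ c
≤-or-≤-of-sum≤double {a} {b} {c} a+b≤2c with a ≤? c
... | yes a≤c = inj₁ a≤c
... | no  a≰c = inj₂ (≤-trans (n≤1+n b) (+-cancelˡ-≤ c (suc b) c (begin
  c + suc b   ≡⟨ +-suc c b ⟩
  suc c + b   ≤⟨ +-monoˡ-≤ b (≰⇒> a≰c) ⟩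
  a + b       ≤⟨ a+b≤2c ⟩
  c + (c + 0) ≡⟨ cong (c +_) (+-identityʳ c) ⟩
  c + c       ∎)))
  where open ≤-Reasoning

good-or-flipped-good : ∀ {n} {G : Graph n} {vs es} → IsSubtree G vs es → ∀ {k l t} →
  length vs ≡ k → numLeaves vs es ≡ l → (σ : Bipartition n) → 2 * t ≤ cutSize σ es →
  2 * laSize σ vs es + 2 * t ≤ 2 * k + l ⊎ 2 * laSize (not ∘ σ) vs es + 2 * t ≤ 2 * k + l
good-or-flipped-good {vs = vs} {es} tree {k} {l} {t} |vs|≡k leaves≡l σ 2t≤cut =
  ≤-or-≤-of-sum≤double (begin
    2 * X + 2 * t + (2 * Y + 2 * t) ≡⟨ collect X Y (2 * t) ⟩
    2 * (X + Y + 2 * t)             ≤⟨ *-monoʳ-≤ 2 (+-monoʳ-≤ (X + Y) 2t≤cut) ⟩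
    2 * (X + Y + cutSize σ es)      ≡⟨ cong (2 *_) (laSize-complement σ vs es) ⟩
    2 * (numLeaves vs es + length vs + length es)
                                    ≡⟨ cong₂ (λ a b → 2 * (a + b + length es)) leaves≡l |vs|≡k ⟩
    2 * (l + k + length es)         ≤⟨ *-monoʳ-≤ 2 (+-monoʳ-≤ (l + k) |es|≤k) ⟩
    2 * (l + k + k)                 ≡⟨ cong (2 *_) (swap l k) ⟩
    2 * (2 * k + l)                 ∎)
  where
  open ≤-Reasoning
  X Y : ℕ
  X = laSize σ vs es
  Y = laSize (not ∘ σ) vs es
  collect : ∀ x y z → 2 * x + z + (2 * y + z) ≡ 2 * (x + y + z)
  collect = solve-∀
  swap : ∀ l k → l + k + k ≡ 2 * k + l
  swap = solve-∀
  |es|≤k : length es ≤ k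
  |es|≤k = ≤-trans (m≤m+n (length es) 1) (≤-reflexive (trans (IsSubtree.edge-count tree) |vs|≡k))

exactCut≤2*goodCount : ∀ {n} {G : Graph n} {vs es} → IsSubtree G vs es → ∀ {k l} t →
  length vs ≡ k → numLeaves vs es ≡ l → ∀ {F} → PeelOrder F → All (_∈ᵤ es) F →
  exactCut F (2 * t) ≤ 2 * goodCount vs es k l t
exactCut≤2*goodCount {n} {vs = vs} {es} tree {k} {l} t |vs|≡k leaves≡l {F} peelF F⊆es = begin
  exactCut F (2 * t)                          ≤⟨ total-mono good-or-flipped ⟩
  total (λ σ → good σ + good (not ∘ σ))       ≡⟨ total-+ good (good ∘ (not ∘_)) ⟩
  total good + total (good ∘ (not ∘_))        ≡⟨ cong (total good +_) (total-not good good-invariant) ⟩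
  total good + total good                     ≡⟨ cong (total good +_) (+-identityʳ (total good)) ⟨
  2 * total good                              ≡⟨ cong (2 *_) (length-filter good? (allBipartitions n)) ⟨
  2 * goodCount vs es k l t                   ∎
  where
  open ≤-Reasoning
  good? : ∀ σ → Dec (2 * laSize σ vs es + 2 * t ≤ 2 * k + l)
  good? σ = 2 * laSize σ vs es + 2 * t ≤? 2 * k + l
  good : Bipartition n → ℕ
  good σ = iverson (does (good? σ))
  good-invariant : Invariant good
  good-invariant σ≗τ = cong (λ a → iverson (does (2 * a + 2 * t ≤? 2 * k + l))) (laSize-cong vs es σ≗τ)
  cut-bound : ∀ σ → T (cutSize σ F ≡ᵇ 2 * t) → 2 * t ≤ cutSize σ es
  cut-bound σ cut≡2t = ≤-trans (≤-reflexive (sym (≡ᵇ⇒≡ (cutSize σ F) (2 * t) cut≡2t)))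
                               (cutSize-mono-peel peelF F⊆es σ)
  good-or-flipped : ∀ σ → iverson (cutSize σ F ≡ᵇ 2 * t) ≤ good σ + good (not ∘ σ)
  good-or-flipped σ with cutSize σ F ≡ᵇ 2 * t in cut≡2t
  ... | false = z≤n
  ... | true with good-or-flipped-good tree {t = t} |vs|≡k leaves≡l σ (cut-bound σ (subst T (sym cut≡2t) tt))
  ... | inj₁ σ-good = ≤-trans (≤-reflexive (sym (iverson-yes (good? σ) σ-good))) (m≤m+n _ _)
  ... | inj₂ σ̄-good = ≤-trans (≤-reflexive (sym (iverson-yes (good? (not ∘ σ)) σ̄-good))) (m≤n+m _ _)

lemma9 : ∀ {n} (G : Graph n) (vs : List (Fin n)) (es : List (Edge n)) (k l t : ℕ)
         → IsSubtree G vs es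
         → length vs ≡ k
         → numLeaves vs es ≡ l
         → 2 * t + 1 ≤ k
         → ((k ∸ 1) C (2 * t)) * 2 ^ n ≤ goodCount vs es k l t * 2 ^ (k + 1)
lemma9 {n} G vs es k l t tree |vs|≡k leaves≡l _ =
  let F , peelF , F⊆es , 1+|F|≡|vs| = spanningPeelOrder tree
      1+|F|≡k = trans 1+|F|≡|vs| |vs|≡k
      good = goodCount vs es k l t
  in begin
  ((k ∸ 1) C (2 * t)) * 2 ^ n         ≡⟨ cong (λ m → ((m ∸ 1) C (2 * t)) * 2 ^ n) 1+|F|≡k ⟨
  (length F C (2 * t)) * 2 ^ n        ≡⟨ exactCut-count peelF (2 * t) ⟨
  exactCut F (2 * t) * 2 ^ length F   ≤⟨ *-monoˡ-≤ (2 ^ length F) (exactCut≤2*goodCount tree t |vs|≡k leaves≡l peelF F⊆es) ⟩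
  2 * good * 2 ^ length F             ≡⟨ trans (cong (_* 2 ^ length F) (*-comm 2 good)) (*-assoc good 2 _) ⟩
  good * 2 ^ suc (length F)           ≤⟨ *-monoʳ-≤ good (^-monoʳ-≤ 2 (≤-trans (≤-reflexive 1+|F|≡k) (m≤m+n k 1))) ⟩
  good * 2 ^ (k + 1)                  ∎
  where open ≤-Reasoning
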